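{- Let $p,q\ge1$ be integers, $\rho=p^2/q^2$, and let $h\ge1$ be an integer. Put $t_x=qh$, $t_y=ph$. Then both the dense-sparse basis and the short-bars basis with parameters $t_x,t_y$ are planar additive bases for the rectangle $[0,t_x^2-1]\times[0,t_y^2-1]$, which has aspect ratio $t_y^2/t_x^2=\rho$, and the efficiency of either basis is \[c=\frac{t_x^2t_y^2}{(2t_xt_y-1)^2}=0.25+O(1/h^2)\quad(h\to\infty).\]
   Context: For integers $m\le n$, $[m,n]$ denotes $\{m,\dots,n\}$; for $t\ge1$ with $t\mid b-a$, $[a,(t),b]=\{a,a+t,\dots,b\}$. A planar additive basis for $R=[0,s_x]\times[0,s_y]$ is a set $A$ of non-negative integer points with $A+A\supseteq R$, where $A+A=\{(x+x',y+y'):(x,y),(x',y')\in A\}$; its efficiency is $N/|A|^2$ with $N=|R|=(s_x+1)(s_y+1)$. The dense-sparse basis with parameters $t_x,t_y\ge1$ is $B\cup C$ with $B=[0,t_x-1]\times[0,t_y-1]$, $C=[0,(t_x),t_x^2-t_x]\times[0,(t_y),t_y^2-t_y]$. The short-bars basis with parameters $t_x,t_y\ge1$ is $B\cup C$ with $B=[0,t_x-1]\times[0,(t_y),t_y^2-t_y]$, $C=[0,(t_x),t_x^2-t_x]\times[0,t_y-1]$. -}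

module Defs where

open import Data.Nat as ℕ using (ℕ; zero; suc; _+_; _*_; _∸_; _≤_; _<_)
open import Data.Integer using (+_)
open import Data.Rational as ℚ using (ℚ; _/_)
open import Data.Product using (Σ; ∃; _×_; _,_)
open import Data.Sum using (_⊎_)
open import Data.List using (List; length)
open import Data.List.Membership.Propositional using (_∈_)
open import Data.List.Relation.Unary.Unique.Propositional using (Unique)
open import Relation.Binary.PropositionalEquality using (_≡_)
open import Function.Bundles using (_⇔_)

Point : Set
Point = ℕ × ℕ

PSet : Set₁
PSet = Point → Set

Interval : ℕ → ℕ → ℕ → Set
Interval m n x = m ≤ x × x ≤ n

AP : ℕ → ℕ → ℕ → ℕ → Set
AP a t b x = Σ ℕ (λ i → x ≡ a + t * i × x ≤ b)

_⊠_ : (ℕ → Set) → (ℕ → Set) → PSet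
(S ⊠ T) (x , y) = S x × T y

_∪_ : PSet → PSet → PSet
(A ∪ B) p = A p ⊎ B p

Rect : ℕ → ℕ → PSet
Rect sx sy = Interval 0 sx ⊠ Interval 0 sy

IsPlanarBasis : PSet → ℕ → ℕ → Set
IsPlanarBasis A sx sy =
  ∀ x y → Rect sx sy (x , y) →
    Σ Point λ a → Σ Point λ b →
      A a × A b × (Data.Product.proj₁ a + Data.Product.proj₁ b ≡ x)
              × (Data.Product.proj₂ a + Data.Product.proj₂ b ≡ y)

HasCard : PSet → ℕ → Set
HasCard A n = Σ (List Point) λ l → Unique l × length l ≡ n × (∀ p → (A p ⇔ (p ∈ l)))

-- a / b as a rational; the denominator 0 case is a dummy convention
-- (never used in the statement, where all denominators are positive).
frac : ℕ → ℕ → ℚ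
frac a zero    = ℚ.0ℚ
frac a (suc k) = (+ a) / suc k

rectSize : ℕ → ℕ → ℕ
rectSize sx sy = suc sx * suc sy

efficiency : ℕ → ℕ → ℕ → ℚ
efficiency sx sy n = frac (rectSize sx sy) (n * n)

aspectRatio : ℕ → ℕ → ℚ
aspectRatio sx sy = frac (suc sy) (suc sx)

denseSparse : ℕ → ℕ → PSet
denseSparse tx ty =
  (Interval 0 (tx ∸ 1) ⊠ Interval 0 (ty ∸ 1))
  ∪ (AP 0 tx (tx * tx ∸ tx) ⊠ AP 0 ty (ty * ty ∸ ty))

shortBars : ℕ → ℕ → PSet
shortBars tx ty =
  (Interval 0 (tx ∸ 1) ⊠ AP 0 ty (ty * ty ∸ ty))
  ∪ (AP 0 tx (tx * tx ∸ tx) ⊠ Interval 0 (ty ∸ 1))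

BasisWithEfficiency : PSet → ℕ → ℕ → ℚ → Set
BasisWithEfficiency A sx sy c =
  IsPlanarBasis A sx sy × Σ ℕ λ n → HasCard A n × efficiency sx sy n ≡ c

cValue : ℕ → ℕ → ℚ
cValue tx ty = frac (tx * tx * (ty * ty)) ((2 * tx * ty ∸ 1) * (2 * tx * ty ∸ 1))

{-# OPTIONS --safe #-}
module Submission where

-- Writing x = r + t·i with 0 ≤ r, i < t (base-t digits) shows that [0,t-1] + [0,(t),t²-t]
-- covers [0,t²-1]; taking the two digits in each coordinate from the two halves of either
-- basis covers the rectangle [0,tx²-1] × [0,ty²-1]. Each basis is the union of two products
-- of tx·ty points meeting only at the origin, so it has n = 2txty - 1 points and efficiency
-- c = (txty)²/(2txty - 1)², whose distance to ¼ is (4txty - 1)/(4(2txty - 1)²) ≤ 1/(txty) ≤ 1/h².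

open import Defs
open import Data.Nat using (ℕ; _*_; _∸_; _≤_)
open import Data.Rational using (ℚ; ∣_∣; _-_; ½)
open import Data.Rational using () renaming (_*_ to _*ℚ_; _≤_ to _≤ℚ_)
open import Data.Product using (Σ; _×_)
open import Relation.Binary.PropositionalEquality using (_≡_)

open import Data.Nat using (zero; suc; _+_; pred; s≤s; z≤n)
import Data.Nat.Properties as ℕ
open import Data.Nat.DivMod using (_/_; _%_; m≡m%n+[m/n]*n; m%n<n; m<n*o⇒m/o<n)
open import Data.Nat.Solver using (module +-*-Solver)
import Data.Integer as ℤ
import Data.Integer.Properties as ℤ
open import Data.Rational as ℚ using (1ℚ; toℚᵘ)
import Data.Rational.Properties as ℚ
open import Data.Rational.Unnormalised as ℚᵘ using (mkℚᵘ; *≡*; *≤*)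
import Data.Rational.Unnormalised.Properties as ℚᵘ
open import Data.Product using (_,_; proj₁; proj₂)
open import Data.Sum using (inj₁; inj₂)
open import Data.Empty using (⊥; ⊥-elim)
open import Data.List using (List; []; _∷_; _++_; map; length; upTo; applyUpTo; cartesianProduct)
import Data.List.Properties as List
open import Data.List.Membership.Propositional using (_∈_)
open import Data.List.Membership.Propositional.Properties
open import Data.List.Relation.Unary.Any using (here; there)
open import Data.List.Relation.Unary.Unique.Propositional using (Unique; tail)
import Data.List.Relation.Unary.Unique.Propositional.Properties as Unique
open import Relation.Binary.PropositionalEquality using (refl; sym; trans; cong; cong₂; subst; subst₂; module ≡-Reasoning)
open import Function.Bundles using (_⇔_; mk⇔; Equivalence)

toℚᵘ-frac : ∀ a k → toℚᵘ (frac a (suc k)) ℚᵘ.≃ mkℚᵘ (ℤ.+ a) k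
toℚᵘ-frac a k = ℚ.toℚᵘ-fromℚᵘ (mkℚᵘ (ℤ.+ a) k)

frac-cong : ∀ a k c l → a * suc l ≡ c * suc k → frac a (suc k) ≡ frac c (suc l)
frac-cong a k c l eq = ℚ.toℚᵘ-injective (ℚᵘ.≃-trans (toℚᵘ-frac a k) (ℚᵘ.≃-trans
  (*≡* (trans (sym (ℤ.pos-* a (suc l))) (trans (cong ℤ.+_ eq) (ℤ.pos-* c (suc k)))))
  (ℚᵘ.≃-sym (toℚᵘ-frac c l))))

frac-mono-≤ : ∀ a k c l → a * suc l ≤ c * suc k → frac a (suc k) ≤ℚ frac c (suc l)
frac-mono-≤ a k c l le = ℚ.toℚᵘ-cancel-≤
  (ℚᵘ.≤-respˡ-≃ (ℚᵘ.≃-sym (toℚᵘ-frac a k)) (ℚᵘ.≤-respʳ-≃ (ℚᵘ.≃-sym (toℚᵘ-frac c l))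
    (*≤* (subst₂ ℤ._≤_ (ℤ.pos-* a (suc l)) (ℤ.pos-* c (suc k)) (ℤ.+≤+ le)))))

∣frac∣≡frac : ∀ a k → ∣ frac a (suc k) ∣ ≡ frac a (suc k)
∣frac∣≡frac a k = ℚ.0≤p⇒∣p∣≡p (frac-mono-≤ 0 0 a k z≤n)

frac-∸-frac : ∀ a k c l → c * suc k ≤ a * suc l →
  frac a (suc k) - frac c (suc l) ≡ frac (a * suc l ∸ c * suc k) (suc k * suc l)
frac-∸-frac a k c l le = ℚ.toℚᵘ-injective (ℚᵘ.≃-trans (ℚ.toℚᵘ-homo-+ (frac a (suc k)) (ℚ.- frac c (suc l)))
  (ℚᵘ.≃-trans (ℚᵘ.+-cong (toℚᵘ-frac a k) (ℚᵘ.≃-trans (ℚ.toℚᵘ-homo‿- (frac c (suc l))) (ℚᵘ.-‿cong (toℚᵘ-frac c l))))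
  (ℚᵘ.≃-trans (ℚᵘ.≃-reflexive (cong (λ z → mkℚᵘ z (pred (suc k * suc l))) numerator)) (ℚᵘ.≃-sym (toℚᵘ-frac _ _)))))
  where
  open ≡-Reasoning
  numerator : ℤ.+ a ℤ.* ℤ.+ suc l ℤ.+ ℤ.- (ℤ.+ c) ℤ.* ℤ.+ suc k ≡ ℤ.+ (a * suc l ∸ c * suc k)
  numerator = begin
    ℤ.+ a ℤ.* ℤ.+ suc l ℤ.+ ℤ.- (ℤ.+ c) ℤ.* ℤ.+ suc k
      ≡⟨ cong₂ ℤ._+_ (sym (ℤ.pos-* a (suc l)))
           (trans (sym (ℤ.neg-distribˡ-* (ℤ.+ c) (ℤ.+ suc k))) (cong ℤ.-_ (sym (ℤ.pos-* c (suc k))))) ⟩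
    ℤ.+ (a * suc l) ℤ.+ ℤ.- ℤ.+ (c * suc k) ≡⟨ ℤ.m-n≡m⊖n (a * suc l) (c * suc k) ⟩
    (a * suc l) ℤ.⊖ (c * suc k)          ≡⟨ ℤ.⊖-≥ le ⟩
    ℤ.+ (a * suc l ∸ c * suc k)             ∎

Enumerates : {X : Set} → (X → Set) → List X → Set
Enumerates A l = Unique l × (∀ x → A x ⇔ x ∈ l)

length-cartesianProduct : {X Y : Set} (xs : List X) (ys : List Y) →
  length (cartesianProduct xs ys) ≡ length xs * length ys
length-cartesianProduct []       ys = refl
length-cartesianProduct (x ∷ xs) ys = trans (List.length-++ (map (x ,_) ys))
  (cong₂ _+_ (List.length-map (x ,_) ys) (length-cartesianProduct xs ys))

enumerates-⊠ : ∀ {S T l m} → Enumerates S l → Enumerates T m → Enumerates (S ⊠ T) (cartesianProduct l m)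
enumerates-⊠ {l = l} {m} (uniqueˡ , S⇔) (uniqueʳ , T⇔) =
  Unique.cartesianProduct⁺ uniqueˡ uniqueʳ , λ { (x , y) → mk⇔
    (λ { (Sx , Ty) → ∈-cartesianProduct⁺ (Equivalence.to (S⇔ x) Sx) (Equivalence.to (T⇔ y) Ty) })
    (λ xy∈ → let (x∈ , y∈) = ∈-cartesianProduct⁻ l m xy∈ in
      Equivalence.from (S⇔ x) x∈ , Equivalence.from (T⇔ y) y∈) }

-- Listing B with the common point o first, dropping it leaves a list disjoint from A's.
enumerates-∪ : ∀ {A B la lb} (o : Point) → A o → (∀ x → A x → B x → x ≡ o) →
  Enumerates A la → Enumerates B (o ∷ lb) → Enumerates (A ∪ B) (la ++ lb)
enumerates-∪ {A} {B} {la} {lb} o Ao A∩B⊆o (uniqueᴬ , A⇔) (uniqueᴮ , B⇔) =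
  Unique.++⁺ uniqueᴬ (tail uniqueᴮ) disjoint , λ x → mk⇔ (into x) (outof x)
  where
  o∉lb : o ∈ lb → ⊥
  o∉lb = Unique.Unique[x∷xs]⇒x∉xs uniqueᴮ
  disjoint : ∀ {x} → x ∈ la × x ∈ lb → ⊥
  disjoint {x} (x∈la , x∈lb) with A∩B⊆o x (Equivalence.from (A⇔ x) x∈la) (Equivalence.from (B⇔ x) (there x∈lb))
  ... | refl = o∉lb x∈lb
  into : ∀ x → (A ∪ B) x → x ∈ la ++ lb
  into x (inj₁ Ax) = ∈-++⁺ˡ (Equivalence.to (A⇔ x) Ax)
  into x (inj₂ Bx) with Equivalence.to (B⇔ x) Bx
  ... | here refl = ∈-++⁺ˡ (Equivalence.to (A⇔ o) Ao)
  ... | there x∈lb = ∈-++⁺ʳ la x∈lb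
  outof : ∀ x → x ∈ la ++ lb → (A ∪ B) x
  outof x x∈ with ∈-++⁻ la x∈
  ... | inj₁ x∈la = inj₁ (Equivalence.from (A⇔ x) x∈la)
  ... | inj₂ x∈lb = inj₂ (Equivalence.from (B⇔ x) (there x∈lb))

-- Sets of naturals listed from 0: the products of two such sets are then both listed from (0,0).
HasCard₀ : (ℕ → Set) → ℕ → Set
HasCard₀ S n = Σ (List ℕ) λ l → Enumerates S (0 ∷ l) × length (0 ∷ l) ≡ n

card-⊠∪⊠ : ∀ {S₁ T₁ S₂ T₂ a₁ b₁ a₂ b₂} →
  HasCard₀ S₁ a₁ → HasCard₀ T₁ b₁ → HasCard₀ S₂ a₂ → HasCard₀ T₂ b₂ →
  (∀ x → S₁ x → S₂ x → x ≡ 0) → (∀ y → T₁ y → T₂ y → y ≡ 0) →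
  HasCard ((S₁ ⊠ T₁) ∪ (S₂ ⊠ T₂)) (a₁ * b₁ + a₂ * b₂ ∸ 1)
card-⊠∪⊠ {S₁} {T₁} {S₂} {T₂} (l₁ , enum-S₁ , refl) (m₁ , enum-T₁ , refl) (l₂ , enum-S₂ , refl) (m₂ , enum-T₂ , refl)
         S₁∩S₂⊆0 T₁∩T₂⊆0 =
  L₁ ++ L₂ , proj₁ enum , size , proj₂ enum
  where
  L₁ L₂ : List Point
  L₁ = cartesianProduct (0 ∷ l₁) (0 ∷ m₁)
  -- cartesianProduct (0 ∷ l₂) (0 ∷ m₂) reduces to (0 , 0) ∷ L₂.
  L₂ = map (0 ,_) m₂ ++ cartesianProduct l₂ (0 ∷ m₂)
  meet : ∀ x → (S₁ ⊠ T₁) x → (S₂ ⊠ T₂) x → x ≡ (0 , 0)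
  meet (x , y) (S₁x , T₁y) (S₂x , T₂y) = cong₂ _,_ (S₁∩S₂⊆0 x S₁x S₂x) (T₁∩T₂⊆0 y T₁y T₂y)
  enum : Enumerates ((S₁ ⊠ T₁) ∪ (S₂ ⊠ T₂)) (L₁ ++ L₂)
  enum = enumerates-∪ (0 , 0) (Equivalence.from (proj₂ enum-S₁ 0) (here refl) , Equivalence.from (proj₂ enum-T₁ 0) (here refl))
    meet (enumerates-⊠ enum-S₁ enum-T₁) (enumerates-⊠ enum-S₂ enum-T₂)
  open ≡-Reasoning
  size : length (L₁ ++ L₂) ≡ length (0 ∷ l₁) * length (0 ∷ m₁) + length (0 ∷ l₂) * length (0 ∷ m₂) ∸ 1
  size = begin
    length (L₁ ++ L₂)                                    ≡⟨ List.length-++ L₁ ⟩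
    length L₁ + length L₂                                ≡⟨ cong (_+ length L₂) (length-cartesianProduct (0 ∷ l₁) (0 ∷ m₁)) ⟩
    length (0 ∷ l₁) * length (0 ∷ m₁) + length L₂        ≡⟨ sym (ℕ.+-∸-assoc (length (0 ∷ l₁) * length (0 ∷ m₁)) (s≤s z≤n)) ⟩
    length (0 ∷ l₁) * length (0 ∷ m₁) + suc (length L₂) ∸ 1
      ≡⟨ cong (λ n → length (0 ∷ l₁) * length (0 ∷ m₁) + n ∸ 1) (length-cartesianProduct (0 ∷ l₂) (0 ∷ m₂)) ⟩
    length (0 ∷ l₁) * length (0 ∷ m₁) + length (0 ∷ l₂) * length (0 ∷ m₂) ∸ 1 ∎

-- [0,t-1] and [0,(t),t²-t] for t = k + 1.
Dense Sparse : ℕ → ℕ → Set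
Dense k = Interval 0 k
Sparse k = AP 0 (suc k) (suc k * suc k ∸ suc k)

t*t∸t≡t*k : ∀ k → suc k * suc k ∸ suc k ≡ suc k * k
t*t∸t≡t*k k = trans (cong (suc k * suc k ∸_) (sym (ℕ.*-identityʳ (suc k)))) (sym (ℕ.*-distribˡ-∸ (suc k) (suc k) 1))

dense-hasCard₀ : ∀ k → HasCard₀ (Dense k) (suc k)
dense-hasCard₀ k = applyUpTo suc k , (Unique.upTo⁺ (suc k) ,
  λ x → mk⇔ (λ (_ , x≤k) → ∈-upTo⁺ (s≤s x≤k)) (λ x∈ → z≤n , ℕ.≤-pred (∈-upTo⁻ x∈))) , List.length-upTo (suc k)

sparse-hasCard₀ : ∀ k → HasCard₀ (Sparse k) (suc k)
sparse-hasCard₀ k = map (_* t) (applyUpTo suc k) ,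
  (Unique.map⁺ (λ {i} {j} → ℕ.*-cancelʳ-≡ i j t) (Unique.upTo⁺ t) , λ x → mk⇔ into outof) ,
  trans (List.length-map (_* t) (upTo t)) (List.length-upTo t)
  where
  t : ℕ
  t = suc k
  into : ∀ {x} → Sparse k x → x ∈ map (_* t) (upTo t)
  into (i , refl , ti≤) = subst (_∈ map (_* t) (upTo t)) (ℕ.*-comm i t)
    (∈-map⁺ (_* t) (∈-upTo⁺ (s≤s (ℕ.*-cancelˡ-≤ t (subst (t * i ≤_) (t*t∸t≡t*k k) ti≤)))))
  outof : ∀ {x} → x ∈ map (_* t) (upTo t) → Sparse k x
  outof x∈ with ∈-map⁻ (_* t) {xs = upTo t} x∈
  ... | i , i∈ , refl = i , ℕ.*-comm i t ,
    subst (i * t ≤_) (sym (t*t∸t≡t*k k)) (subst (_≤ t * k) (ℕ.*-comm t i) (ℕ.*-monoʳ-≤ t (ℕ.≤-pred (∈-upTo⁻ i∈))))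

dense∩sparse⊆0 : ∀ k x → Dense k x → Sparse k x → x ≡ 0
dense∩sparse⊆0 k x _          (zero , refl , _) = ℕ.*-zeroʳ (suc k)
dense∩sparse⊆0 k x (_ , x≤k) (suc i , refl , _) =
  ⊥-elim (ℕ.<-irrefl refl (ℕ.<-≤-trans (s≤s x≤k) (ℕ.m≤m*n (suc k) (suc i))))

dense+sparse-cover : ∀ k x → x ≤ suc k * suc k ∸ 1 → Σ ℕ λ r → Σ ℕ λ m → Dense k r × Sparse k m × r + m ≡ x
dense+sparse-cover k x x≤ = x % t , t * (x / t) , (z≤n , ℕ.≤-pred (m%n<n x t)) ,
  (x / t , refl , subst (t * (x / t) ≤_) (sym (t*t∸t≡t*k k)) (ℕ.*-monoʳ-≤ t (ℕ.≤-pred (m<n*o⇒m/o<n {x} {t} {t} (s≤s x≤))))) ,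
  trans (cong (x % t +_) (ℕ.*-comm t (x / t))) (sym (m≡m%n+[m/n]*n x t))
  where
  t : ℕ
  t = suc k

module _ (kx ky : ℕ) where

  private
    tx ty : ℕ
    tx = suc kx
    ty = suc ky

    card-as-double : tx * ty + tx * ty ∸ 1 ≡ 2 * tx * ty ∸ 1
    card-as-double = cong (_∸ 1) (trans (cong (tx * ty +_) (sym (ℕ.+-identityʳ (tx * ty)))) (sym (ℕ.*-assoc 2 tx ty)))

  denseSparse-isBasis : IsPlanarBasis (denseSparse tx ty) (tx * tx ∸ 1) (ty * ty ∸ 1)
  denseSparse-isBasis x y ((_ , x≤) , (_ , y≤))
    with dense+sparse-cover kx x x≤ | dense+sparse-cover ky y y≤
  ... | rx , mx , rx∈ , mx∈ , refl | ry , my , ry∈ , my∈ , refl =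
    (rx , ry) , (mx , my) , inj₁ (rx∈ , ry∈) , inj₂ (mx∈ , my∈) , refl , refl

  shortBars-isBasis : IsPlanarBasis (shortBars tx ty) (tx * tx ∸ 1) (ty * ty ∸ 1)
  shortBars-isBasis x y ((_ , x≤) , (_ , y≤))
    with dense+sparse-cover kx x x≤ | dense+sparse-cover ky y y≤
  ... | rx , mx , rx∈ , mx∈ , refl | ry , my , ry∈ , my∈ , refl =
    (rx , my) , (mx , ry) , inj₁ (rx∈ , my∈) , inj₂ (mx∈ , ry∈) , refl , ℕ.+-comm my ry

  denseSparse-hasCard : HasCard (denseSparse tx ty) (2 * tx * ty ∸ 1)
  denseSparse-hasCard = subst (HasCard (denseSparse tx ty)) card-as-double
    (card-⊠∪⊠ (dense-hasCard₀ kx) (dense-hasCard₀ ky) (sparse-hasCard₀ kx) (sparse-hasCard₀ ky)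
      (dense∩sparse⊆0 kx) (dense∩sparse⊆0 ky))

  shortBars-hasCard : HasCard (shortBars tx ty) (2 * tx * ty ∸ 1)
  shortBars-hasCard = subst (HasCard (shortBars tx ty)) card-as-double
    (card-⊠∪⊠ (dense-hasCard₀ kx) (sparse-hasCard₀ ky) (sparse-hasCard₀ kx) (dense-hasCard₀ ky)
      (dense∩sparse⊆0 kx) (λ y Sy Dy → dense∩sparse⊆0 ky y Dy Sy))

  -- The efficiency is cValue on the nose: suc (tx * tx ∸ 1) computes to tx * tx.
  denseSparse-basis : BasisWithEfficiency (denseSparse tx ty) (tx * tx ∸ 1) (ty * ty ∸ 1) (cValue tx ty)
  denseSparse-basis = denseSparse-isBasis , 2 * tx * ty ∸ 1 , denseSparse-hasCard , refl

  shortBars-basis : BasisWithEfficiency (shortBars tx ty) (tx * tx ∸ 1) (ty * ty ∸ 1) (cValue tx ty)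
  shortBars-basis = shortBars-isBasis , 2 * tx * ty ∸ 1 , shortBars-hasCard , refl

cValue-of-product : ∀ tx ty u → tx * ty ≡ suc u → cValue tx ty ≡ frac (suc u * suc u) (suc (2 * u) * suc (2 * u))
cValue-of-product tx ty u txty≡n = cong₂ frac numerator (cong₂ _*_ denominator denominator)
  where
  numerator : tx * tx * (ty * ty) ≡ suc u * suc u
  numerator = trans (ℕ.[m*n]*[o*p]≡[m*o]*[n*p] tx tx ty ty) (cong₂ _*_ txty≡n txty≡n)
  denominator : 2 * tx * ty ∸ 1 ≡ suc (2 * u)
  denominator = trans (cong (_∸ 1) (trans (ℕ.*-assoc 2 tx ty) (cong (2 *_) txty≡n))) (ℕ.+-suc u (u + 0))

-- n²/(2n-1)² - ¼ = (4n-1)/(4(2n-1)²), written with n = u + 1.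
square-ratio-near-quarter : ∀ u → ∣ frac (suc u * suc u) (suc (2 * u) * suc (2 * u)) - ½ *ℚ ½ ∣ ≤ℚ frac 1 (suc u)
square-ratio-near-quarter u = begin
  ∣ frac n² D - ½ *ℚ ½ ∣          ≡⟨ cong ∣_∣ (frac-∸-frac n² (pred D) 1 3 D≤4n²) ⟩
  ∣ frac (n² * 4 ∸ 1 * D) (D * 4) ∣ ≡⟨ ∣frac∣≡frac (n² * 4 ∸ 1 * D) (pred (D * 4)) ⟩
  frac (n² * 4 ∸ 1 * D) (D * 4)   ≡⟨ cong (λ a → frac a (D * 4)) gap-numerator ⟩
  frac (3 + 4 * u) (D * 4)        ≤⟨ frac-mono-≤ (3 + 4 * u) (pred (D * 4)) 1 u gap-bound ⟩
  frac 1 (suc u)                  ∎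
  where
  open ℚ.≤-Reasoning
  open +-*-Solver
  n² D : ℕ
  n² = suc u * suc u
  D = suc (2 * u) * suc (2 * u)
  4n²≡gap+D : n² * 4 ≡ (3 + 4 * u) + 1 * D
  4n²≡gap+D = solve 1 (λ u → (con 1 :+ u) :* (con 1 :+ u) :* con 4
    := (con 3 :+ con 4 :* u) :+ con 1 :* ((con 1 :+ con 2 :* u) :* (con 1 :+ con 2 :* u))) refl u
  D≤4n² : 1 * D ≤ n² * 4
  D≤4n² = subst (1 * D ≤_) (sym 4n²≡gap+D) (ℕ.m≤n+m (1 * D) (3 + 4 * u))
  gap-numerator : n² * 4 ∸ 1 * D ≡ 3 + 4 * u
  gap-numerator = trans (cong (_∸ 1 * D) 4n²≡gap+D) (ℕ.m+n∸n≡m (3 + 4 * u) (1 * D))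
  4D≡gap*n+rest : 1 * (D * 4) ≡ (3 + 4 * u) * suc u + (1 + 9 * u + 12 * (u * u))
  4D≡gap*n+rest = solve 1 (λ u → con 1 :* ((con 1 :+ con 2 :* u) :* (con 1 :+ con 2 :* u) :* con 4)
    := (con 3 :+ con 4 :* u) :* (con 1 :+ u) :+ (con 1 :+ con 9 :* u :+ con 12 :* (u :* u))) refl u
  gap-bound : (3 + 4 * u) * suc u ≤ 1 * (D * 4)
  gap-bound = subst ((3 + 4 * u) * suc u ≤_) (sym 4D≡gap*n+rest) (ℕ.m≤m+n _ _)

cValue-near-quarter : ∀ kx ky → ∣ cValue (suc kx) (suc ky) - ½ *ℚ ½ ∣ ≤ℚ frac 1 (suc kx * suc ky)
cValue-near-quarter kx ky = subst (λ c → ∣ c - ½ *ℚ ½ ∣ ≤ℚ frac 1 (suc kx * suc ky))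
  (sym (cValue-of-product (suc kx) (suc ky) (pred (suc kx * suc ky)) refl))
  (square-ratio-near-quarter (pred (suc kx * suc ky)))

frac1-antitone : ∀ m n → suc m ≤ suc n → frac 1 (suc n) ≤ℚ frac 1 (suc m)
frac1-antitone m n m<n = frac-mono-≤ 1 n 1 m (ℕ.*-monoʳ-≤ 1 m<n)

frac-squares-cancel : ∀ a k h → frac (a * suc h * (a * suc h)) (suc k * suc h * (suc k * suc h)) ≡ frac (a * a) (suc k * suc k)
frac-squares-cancel a k h =
  frac-cong (a * suc h * (a * suc h)) (pred (suc k * suc h * (suc k * suc h))) (a * a) (pred (suc k * suc k))
  (solve 3 (λ a k h → a :* h :* (a :* h) :* (k :* k) := a :* a :* (k :* h :* (k :* h))) refl a (suc k) (suc h))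
  where open +-*-Solver

corollary1 : (p q : ℕ) → 1 ≤ p → 1 ≤ q →
    ((h : ℕ) → 1 ≤ h →
      BasisWithEfficiency (denseSparse (q * h) (p * h)) ((q * h) * (q * h) ∸ 1) ((p * h) * (p * h) ∸ 1) (cValue (q * h) (p * h))
      × BasisWithEfficiency (shortBars (q * h) (p * h)) ((q * h) * (q * h) ∸ 1) ((p * h) * (p * h) ∸ 1) (cValue (q * h) (p * h))
      × aspectRatio ((q * h) * (q * h) ∸ 1) ((p * h) * (p * h) ∸ 1) ≡ frac ((p * h) * (p * h)) ((q * h) * (q * h))
      × frac ((p * h) * (p * h)) ((q * h) * (q * h)) ≡ frac (p * p) (q * q))
    × Σ ℚ (λ K → (h : ℕ) → 1 ≤ h →
        ∣ cValue (q * h) (p * h) - (½ *ℚ ½) ∣ ≤ℚ K *ℚ frac 1 (h * h))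
corollary1 p@(suc _) q@(suc _) _ _ =
    -- With p, q, h successors, q * h computes to a successor, so suc (pred (q * h)) is q * h.
    (λ { h@(suc h′) _ →
        denseSparse-basis (pred (q * h)) (pred (p * h)) , shortBars-basis (pred (q * h)) (pred (p * h))
      , refl , frac-squares-cancel p (pred q) h′ })
  , 1ℚ , gap
  where
  gap : ∀ h → 1 ≤ h → ∣ cValue (q * h) (p * h) - ½ *ℚ ½ ∣ ≤ℚ 1ℚ *ℚ frac 1 (h * h)
  gap h@(suc _) _ = begin
    ∣ cValue (q * h) (p * h) - ½ *ℚ ½ ∣ ≤⟨ cValue-near-quarter (pred (q * h)) (pred (p * h)) ⟩
    frac 1 (q * h * (p * h))           ≤⟨ frac1-antitone _ _ (ℕ.*-mono-≤ (ℕ.m≤n*m h q) (ℕ.m≤n*m h p)) ⟩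
    frac 1 (h * h)                     ≡⟨ ℚ.*-identityˡ (frac 1 (h * h)) ⟨
    1ℚ *ℚ frac 1 (h * h)               ∎
    where open ℚ.≤-Reasoning
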